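{- Let $R^1,R^2,S^1,S^2\in\mathfrak{P}$. If $R^1\sqsubseteq S^1$ and $R^2\sqsubseteq S^2$, then $R^1\times R^2\sqsubseteq S^1\times S^2$. If $R^1\sqsubseteq_G S^1$ and $R^2\sqsubseteq_G S^2$, then $R^1\times R^2\sqsubseteq_G S^1\times S^2$.
   Context: $\mathfrak{P}$ is the class of finite nonempty posets and $\mathfrak{P}_r$ a fixed system of representatives of its isomorphism classes. $A\times B$ is the product poset with componentwise order. $\mathcal{H}(P,Q)$ is the set of order-preserving maps $P\to Q$. For $A\subseteq P$, $x\in A$: $\gamma_A(x)$ is the set of $y\in A$ joined to $x$ by a sequence $x=z_0,\dots,z_L=y$ in $A$ ($L\ge0$) with consecutive elements strictly comparable; for a map $\xi$ on $P$, $G_\xi(x):=\gamma_{\xi^{ -1}(\xi(x))}(x)$. A Hom-scheme from $R$ to $S$ is a family $(\rho_P)_{P\in\mathfrak{P}_r}$ of maps $\rho_P:\mathcal{H}(P,R)\to\mathcal{H}(P,S)$; strong if every $\rho_P$ is injective; a G-scheme if $G_{\rho_P(\xi)}(x)=G_\xi(x)$ for all $P\in\mathfrak{P}_r$, $\xi\in\mathcal{H}(P,R)$, $x\in P$. $R\sqsubseteq S$ / $R\sqsubseteq_G S$ mean existence of a strong Hom-scheme / strong G-scheme from $R$ to $S$. -}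

module Defs where

open import Data.Nat using (ℕ; suc)
open import Data.Fin using (Fin)
open import Data.Product using (Σ; ∃; _×_; _,_; proj₁; proj₂)
open import Data.Sum using (_⊎_)
open import Function.Bundles using (_↔_; _⇔_; Inverse)
open import Relation.Binary.Structures using (IsPartialOrder; IsPreorder)
open import Relation.Binary.PropositionalEquality
  using (_≡_; _≢_; refl; cong₂; isEquivalence)

record Pos : Set₁ where
  field
    Carrier        : Set
    _≤_            : Carrier → Carrier → Set
    isPartialOrder : IsPartialOrder _≡_ _≤_

  _<_ : Carrier → Carrier → Set
  x < y = (x ≤ y) × (x ≢ y)

  StrictlyComparable : Carrier → Carrier → Set
  StrictlyComparable x y = (x < y) ⊎ (y < x)

open Pos public using (Carrier)

-- Finite nonempty posets (the class 𝔓): a poset whose carrier is in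
-- bijection with Fin (suc n) for some n.
record FinPos : Set₁ where
  field
    pos  : Pos
    size : ℕ
    enum : Carrier pos ↔ Fin (suc size)

open FinPos public using (pos)

_×P_ : Pos → Pos → Pos
A ×P B = record
  { Carrier        = Carrier A × Carrier B
  ; _≤_            = λ p q → (Pos._≤_ A (proj₁ p) (proj₁ q)) × (Pos._≤_ B (proj₂ p) (proj₂ q))
  ; isPartialOrder = record
    { isPreorder = record
      { isEquivalence = isEquivalence
      ; reflexive     = λ { refl → IsPartialOrder.refl (Pos.isPartialOrder A)
                                 , IsPartialOrder.refl (Pos.isPartialOrder B) }
      ; trans         = λ { (a , b) (c , d) →
                              IsPartialOrder.trans (Pos.isPartialOrder A) a c
                            , IsPartialOrder.trans (Pos.isPartialOrder B) b d }
      }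
    ; antisym    = λ { (a , b) (c , d) →
                         cong₂ _,_ (IsPartialOrder.antisym (Pos.isPartialOrder A) a c)
                                   (IsPartialOrder.antisym (Pos.isPartialOrder B) b d) }
    }
  }

record Hom (P Q : Pos) : Set where
  field
    fun  : Carrier P → Carrier Q
    mono : ∀ {x y} → Pos._≤_ P x y → Pos._≤_ Q (fun x) (fun y)

open Hom public

_≈H_ : ∀ {P Q} → Hom P Q → Hom P Q → Set
ξ ≈H η = ∀ x → fun ξ x ≡ fun η x

record Iso (P Q : Pos) : Set where
  field
    bij   : Carrier P ↔ Carrier Q
    order : ∀ x y → Pos._≤_ P x y ⇔ Pos._≤_ Q (Inverse.to bij x) (Inverse.to bij y)

record RepSystem : Set₁ where
  field
    Index    : Set
    rep      : Index → FinPos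
    complete : (Q : FinPos) → ∃ λ i → Iso (pos Q) (pos (rep i))
    distinct : (i j : Index) → Iso (pos (rep i)) (pos (rep j)) → i ≡ j

data Chain (P : Pos) (A : Carrier P → Set) : Carrier P → Carrier P → Set where
  here : ∀ {x} → A x → Chain P A x x
  step : ∀ {x y z} → A x → Pos.StrictlyComparable P x y → Chain P A y z → Chain P A x z

γ : (P : Pos) → (Carrier P → Set) → Carrier P → Carrier P → Set
γ P A x y = Chain P A x y

G : (P : Pos) {B : Set} → (Carrier P → B) → Carrier P → Carrier P → Set
G P ξ x y = γ P (λ z → ξ z ≡ ξ x) x y

module _ (𝔯 : RepSystem) where
  open RepSystem 𝔯

  HomScheme : Pos → Pos → Set
  HomScheme R S = (i : Index) → Hom (pos (rep i)) R → Hom (pos (rep i)) S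

  IsStrong : ∀ {R S} → HomScheme R S → Set
  IsStrong ρ = ∀ i (ξ η : Hom _ _) → ρ i ξ ≈H ρ i η → ξ ≈H η

  IsGScheme : ∀ {R S} → HomScheme R S → Set
  IsGScheme ρ = ∀ i (ξ : Hom _ _) (x y : Carrier (pos (rep i))) →
    G (pos (rep i)) (fun (ρ i ξ)) x y ⇔ G (pos (rep i)) (fun ξ) x y

  _⊑_ : Pos → Pos → Set
  R ⊑ S = Σ (HomScheme R S) IsStrong

  _⊑G_ : Pos → Pos → Set
  R ⊑G S = Σ (HomScheme R S) λ ρ → IsStrong ρ × IsGScheme ρ

-- The product scheme applies the two schemes to the two coordinate maps of
-- ξ : P → R¹ × R² and pairs the results.  Injectivity is checked coordinatewise.
-- For the G-condition, note that every point z reachable from x by a chain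
-- inside the fibre of ⟨ξ₁ , ξ₂⟩ lies in G_{ξ₁}(x) ∩ G_{ξ₂}(x) = G_{η₁}(x) ∩ G_{η₂}(x),
-- so η₁ and η₂ are both constant along that chain, which therefore also
-- witnesses z ∈ G_{⟨η₁ , η₂⟩}(x).
module Submission where

open import Defs
open import Data.Product using (_×_; _,_; proj₁; proj₂)
open import Function.Base using (_∘_)
open import Function.Bundles using (_⇔_; mk⇔; Equivalence)
open import Relation.Binary.PropositionalEquality using (cong; cong₂)

module _ {P : Pos} where

  chain-first : ∀ {A x y} → Chain P A x y → A x
  chain-first (here a)     = a
  chain-first (step a _ _) = a

  chain-last : ∀ {A x y} → Chain P A x y → A y
  chain-last (here a)     = a
  chain-last (step _ _ c) = chain-last c

  chain-snoc : ∀ {A x y z} → Chain P A x y → Pos.StrictlyComparable P y z → A z →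
               Chain P A x z
  chain-snoc (here a)     s a′ = step a s (here a′)
  chain-snoc (step a r c) s a′ = step a r (chain-snoc c s a′)

  chain-map : ∀ {A B : Carrier P → Set} {x y} → (∀ {z} → A z → B z) →
              Chain P A x y → Chain P B x y
  chain-map f (here a)     = here (f a)
  chain-map f (step a s c) = step (f a) s (chain-map f c)

  γ-within : ∀ {A B : Carrier P → Set} {x y} → (∀ {z} → γ P A x z → B z) →
             γ P A x y → γ P B x y
  γ-within {A} {B} {x} inB c = go (here (chain-first c)) c
    where
    go : ∀ {w y} → Chain P A x w → Chain P A w y → Chain P B w y
    go pre (here a)     = here (inB pre)
    go pre (step a s c) = step (inB pre) s (go (chain-snoc pre s (chain-first c)) c)

  G-pair-mono : ∀ {B₁ B₂ C₁ C₂ : Set}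
                  {ξ₁ : Carrier P → B₁} {ξ₂ : Carrier P → B₂}
                  {η₁ : Carrier P → C₁} {η₂ : Carrier P → C₂} →
                (∀ {x y} → G P ξ₁ x y → G P η₁ x y) →
                (∀ {x y} → G P ξ₂ x y → G P η₂ x y) →
                ∀ {x y} → G P (λ z → ξ₁ z , ξ₂ z) x y → G P (λ z → η₁ z , η₂ z) x y
  G-pair-mono G₁ G₂ = γ-within λ c →
    cong₂ _,_ (chain-last (G₁ (chain-map (cong proj₁) c)))
              (chain-last (G₂ (chain-map (cong proj₂) c)))

  G-pair-cong : ∀ {B₁ B₂ C₁ C₂ : Set}
                  {ξ₁ : Carrier P → B₁} {ξ₂ : Carrier P → B₂}
                  {η₁ : Carrier P → C₁} {η₂ : Carrier P → C₂} →
                (∀ x y → G P ξ₁ x y ⇔ G P η₁ x y) →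
                (∀ x y → G P ξ₂ x y ⇔ G P η₂ x y) →
                ∀ x y → G P (λ z → ξ₁ z , ξ₂ z) x y ⇔ G P (λ z → η₁ z , η₂ z) x y
  G-pair-cong G₁ G₂ x y = mk⇔
    (G-pair-mono (Equivalence.to   (G₁ _ _)) (Equivalence.to   (G₂ _ _)))
    (G-pair-mono (Equivalence.from (G₁ _ _)) (Equivalence.from (G₂ _ _)))

module _ {P R¹ R² : Pos} where

  proj₁ᴴ : Hom P (R¹ ×P R²) → Hom P R¹
  proj₁ᴴ ξ = record { fun = proj₁ ∘ fun ξ ; mono = proj₁ ∘ mono ξ }

  proj₂ᴴ : Hom P (R¹ ×P R²) → Hom P R²
  proj₂ᴴ ξ = record { fun = proj₂ ∘ fun ξ ; mono = proj₂ ∘ mono ξ }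

  ⟨_,_⟩ᴴ : Hom P R¹ → Hom P R² → Hom P (R¹ ×P R²)
  ⟨ f , g ⟩ᴴ = record { fun = λ x → fun f x , fun g x ; mono = λ le → mono f le , mono g le }

module _ (𝔯 : RepSystem) {R¹ R² S¹ S² : Pos} where

  _×ρ_ : HomScheme 𝔯 R¹ S¹ → HomScheme 𝔯 R² S² → HomScheme 𝔯 (R¹ ×P R²) (S¹ ×P S²)
  (ρ₁ ×ρ ρ₂) i ξ = ⟨ ρ₁ i (proj₁ᴴ ξ) , ρ₂ i (proj₂ᴴ ξ) ⟩ᴴ

  ×ρ-strong : ∀ {ρ₁ ρ₂} → IsStrong 𝔯 ρ₁ → IsStrong 𝔯 ρ₂ → IsStrong 𝔯 (ρ₁ ×ρ ρ₂)
  ×ρ-strong inj₁ inj₂ i ξ η eq x =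
    cong₂ _,_ (inj₁ i (proj₁ᴴ ξ) (proj₁ᴴ η) (cong proj₁ ∘ eq) x)
              (inj₂ i (proj₂ᴴ ξ) (proj₂ᴴ η) (cong proj₂ ∘ eq) x)

  ×ρ-G : ∀ {ρ₁ ρ₂} → IsGScheme 𝔯 ρ₁ → IsGScheme 𝔯 ρ₂ → IsGScheme 𝔯 (ρ₁ ×ρ ρ₂)
  ×ρ-G G₁ G₂ i ξ = G-pair-cong (G₁ i (proj₁ᴴ ξ)) (G₂ i (proj₂ᴴ ξ))

  ×-⊑ : _⊑_ 𝔯 R¹ S¹ → _⊑_ 𝔯 R² S² → _⊑_ 𝔯 (R¹ ×P R²) (S¹ ×P S²)
  ×-⊑ (ρ₁ , s₁) (ρ₂ , s₂) = ρ₁ ×ρ ρ₂ , ×ρ-strong {ρ₁} {ρ₂} s₁ s₂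

  ×-⊑G : _⊑G_ 𝔯 R¹ S¹ → _⊑G_ 𝔯 R² S² → _⊑G_ 𝔯 (R¹ ×P R²) (S¹ ×P S²)
  ×-⊑G (ρ₁ , s₁ , g₁) (ρ₂ , s₂ , g₂) = ρ₁ ×ρ ρ₂ , ×ρ-strong {ρ₁} {ρ₂} s₁ s₂ , ×ρ-G {ρ₁} {ρ₂} g₁ g₂

proposition5 : (𝔯 : RepSystem) (R¹ R² S¹ S² : FinPos) →
    (_⊑_ 𝔯 (pos R¹) (pos S¹) → _⊑_ 𝔯 (pos R²) (pos S²) →
      _⊑_ 𝔯 (pos R¹ ×P pos R²) (pos S¹ ×P pos S²))
    × (_⊑G_ 𝔯 (pos R¹) (pos S¹) → _⊑G_ 𝔯 (pos R²) (pos S²) →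
      _⊑G_ 𝔯 (pos R¹ ×P pos R²) (pos S¹ ×P pos S²))
proposition5 𝔯 R¹ R² S¹ S² = ×-⊑ 𝔯 , ×-⊑G 𝔯
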